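{- The pointed set species $\mathbf{C}$ of coloring problems, with the product of coloring problems, is a monoid: for disjoint finite sets $M,N$ and coloring problems $\mathbf{c}$ on $M$, $\mathbf{d}$ on $N$, $\mathbf{c}\cdot\mathbf{d}$ is a coloring problem on $M\sqcup N$, and the product satisfies naturality, associativity, unitality and absorption.
   Context: A coloring problem on a finite set $N$ is a pair $(\mathbf{p},I)$ where $\mathbf{p}$ is a family of subsets of $N$ with $\emptyset,N\in\mathbf{p}$, ordered by inclusion, and $I$ is an order ideal of the poset $\mathrm{Int}(\mathbf{p})$ of intervals $[S,T]$ ($S\subseteq T$ in $\mathbf{p}$, ordered by inclusion) containing $[S,S]$ for all $S\in\mathbf{p}$. The species $\mathbf{C}$ assigns to each finite set $N$ the pointed set $\mathbf{C}_N=\{0\}\sqcup\{\text{coloring problems on }N\}$ with base point $0$, and to a bijection $\sigma:M\to N$ the map $\mathbf{C}_\sigma(0)=0$, $\mathbf{C}_\sigma(\mathbf{p},I)=(\{\sigma(S):S\in\mathbf{p}\},\{[\sigma(S),\sigma(T)]:[S,T]\in I\})$. The product of $(\mathbf{p},I)$ on $M$ and $(\mathbf{q},J)$ on disjoint $N$ is $(\mathbf{p}\cdot\mathbf{q},I\cdot J)$ with $\mathbf{p}\cdot\mathbf{q}=\{X\cup Y:X\in\mathbf{p},Y\in\mathbf{q}\}$, $I\cdot J=\{[X\cup Y,X'\cup Y']:[X,X']\in I,[Y,Y']\in J\}$, and $0\cdot\mathbf{x}=\mathbf{x}\cdot0=0$. The unit is $1=(\{\emptyset\},\{[\emptyset,\emptyset]\})\in\mathbf{C}_\emptyset$.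 A pointed set species $\mathbf{F}$ (with $\mathbf{F}_\emptyset=\{0,1\}$) is a monoid if for all disjoint $S,T$ there is a product $\mathbf{F}_S\times\mathbf{F}_T\to\mathbf{F}_{S\sqcup T}$ satisfying: naturality ($\mathbf{F}_\sigma(\mathbf{x}\cdot\mathbf{y})=\mathbf{F}_{\sigma|_S}(\mathbf{x})\cdot\mathbf{F}_{\sigma|_T}(\mathbf{y})$ for bijections $\sigma$ of $S\sqcup T$); associativity; unitality ($1\cdot\mathbf{x}=\mathbf{x}=\mathbf{x}\cdot1$); absorption ($\mathbf{x}\cdot\mathbf{y}=0$ if $\mathbf{x}=0$ or $\mathbf{y}=0$). -}

module Defs where

open import Data.Nat using (ℕ)
open import Data.Fin using (Fin)
open import Data.Fin.Subset using (Subset; _⊆_; _∪_; _∩_; ⊥; Empty)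
open import Data.Fin.Permutation using (Permutation′; _⟨$⟩ˡ_)
open import Data.Vec using (tabulate; lookup)
open import Data.Product using (Σ; ∃; ∃₂; _×_; _,_)
open import Data.Sum using (_⊎_)
open import Data.Maybe using (Maybe; just; nothing)
open import Data.Unit using (⊤)
open import Data.Empty renaming (⊥ to False)
open import Function.Bundles using (_⇔_)
open import Relation.Binary.PropositionalEquality using (_≡_)

-- Convention: all finite sets are subsets of a fixed finite universe Fin k
-- (k arbitrary).
-- Set-theoretic union / disjointness are the literal operations on subsets.

-- Raw data of a coloring problem: a family p of subsets and a set I of
-- intervals [S,T] (given as pairs (S,T)).
record Raw (k : ℕ) : Set₁ where
  constructor mkRaw
  field
    fam   : Subset k → Set
    ideal : Subset k → Subset k → Set
open Raw public

record IsColoringProblem {k : ℕ} (N : Subset k) (c : Raw k) : Set where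
  field
    fam-sub    : ∀ S → fam c S → S ⊆ N
    fam-empty  : fam c ⊥
    fam-full   : fam c N
    ideal-int  : ∀ S T → ideal c S T → fam c S × fam c T × S ⊆ T
    -- I is an order ideal of Int(p) (intervals ordered by inclusion:
    -- [S',T'] ⊆ [S,T] iff S ⊆ S' ⊆ T' ⊆ T)
    ideal-down : ∀ S T S' T' → ideal c S T → fam c S' → fam c T' →
                 S ⊆ S' → S' ⊆ T' → T' ⊆ T → ideal c S' T'
    ideal-diag : ∀ S → fam c S → ideal c S S

-- The pointed set C_N : 0 is 'nothing', coloring problems are 'just c'.
data InC {k : ℕ} (N : Subset k) : Maybe (Raw k) → Set₁ where
  zeroC : InC N nothing
  cpC   : ∀ c → IsColoringProblem N c → InC N (just c)

record _≈R_ {k : ℕ} (c d : Raw k) : Set where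
  field
    fam-eq   : ∀ Z → fam c Z ⇔ fam d Z
    ideal-eq : ∀ Z Z' → ideal c Z Z' ⇔ ideal d Z Z'

_≈C_ : {k : ℕ} → Maybe (Raw k) → Maybe (Raw k) → Set
nothing ≈C nothing = ⊤
just c  ≈C just d  = c ≈R d
_       ≈C _       = False

_·R_ : {k : ℕ} → Raw k → Raw k → Raw k
c ·R d = mkRaw
  (λ Z → ∃₂ λ X Y → fam c X × fam d Y × Z ≡ X ∪ Y)
  (λ Z Z' → ∃₂ λ X X' → ∃₂ λ Y Y' →
      ideal c X X' × ideal d Y Y' × Z ≡ X ∪ Y × Z' ≡ X' ∪ Y')

_·_ : {k : ℕ} → Maybe (Raw k) → Maybe (Raw k) → Maybe (Raw k)
nothing · _      = nothing
just _  · nothing = nothing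
just c  · just d  = just (c ·R d)

unitC : {k : ℕ} → Maybe (Raw k)
unitC = just (mkRaw (λ Z → Z ≡ ⊥) (λ Z Z' → Z ≡ ⊥ × Z' ≡ ⊥))

img : {k : ℕ} → Permutation′ k → Subset k → Subset k
img σ S = tabulate (λ j → lookup S (σ ⟨$⟩ˡ j))

mapR : {k : ℕ} → Permutation′ k → Raw k → Raw k
mapR σ c = mkRaw
  (λ Z → ∃ λ S → fam c S × Z ≡ img σ S)
  (λ Z Z' → ∃₂ λ S T → ideal c S T × Z ≡ img σ S × Z' ≡ img σ T)

mapC : {k : ℕ} → Permutation′ k → Maybe (Raw k) → Maybe (Raw k)
mapC σ nothing  = nothing
mapC σ (just c) = just (mapR σ c)

Disjoint : {k : ℕ} → Subset k → Subset k → Set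
Disjoint M N = Empty (M ∩ N)

ProductClosed : ℕ → Set₁
ProductClosed k = ∀ (M N : Subset k) (c d : Raw k) → Disjoint M N →
  IsColoringProblem M c → IsColoringProblem N d →
  IsColoringProblem (M ∪ N) (c ·R d)

Naturality : ℕ → Set₁
Naturality k = ∀ (σ : Permutation′ k) (M N : Subset k) (x y : Maybe (Raw k)) →
  Disjoint M N → InC M x → InC N y →
  mapC σ (x · y) ≈C (mapC σ x · mapC σ y)

Associativity : ℕ → Set₁
Associativity k = ∀ (L M N : Subset k) (x y z : Maybe (Raw k)) →
  Disjoint L M → Disjoint L N → Disjoint M N →
  InC L x → InC M y → InC N z →
  ((x · y) · z) ≈C (x · (y · z))

Unitality : ℕ → Set₁
Unitality k = ∀ (N : Subset k) (x : Maybe (Raw k)) → InC N x →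
  ((unitC · x) ≈C x) × ((x · unitC) ≈C x)

Absorption : ℕ → Set₁
Absorption k = ∀ (M N : Subset k) (x y : Maybe (Raw k)) → Disjoint M N →
  InC M x → InC N y →
  (x ≡ nothing ⊎ y ≡ nothing) → (x · y) ≡ nothing

-- Everything is inherited from the lattice of subsets: associativity and unit
-- laws come from those of ∪ and ⊥, and naturality from img σ preserving ∪.
-- The only real point is that c · d is again a coloring problem, where the
-- order-ideal property needs disjointness: for X, X' ⊆ M and Y, Y' ⊆ N, the
-- inclusion X ∪ Y ⊆ X' ∪ Y' splits into X ⊆ X' and Y ⊆ Y', so an interval of
-- c · d below [X ∪ Y, X' ∪ Y'] is a product of intervals below [X, X'] and [Y, Y'].
module Submission where

open import Defs
open import Data.Nat using (ℕ)
open import Data.Fin using (Fin)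
open import Data.Fin.Subset using (Subset; ⊥; _⊆_; _∪_; _∈_)
open import Data.Fin.Subset.Properties
  using (∪-assoc; ∪-identityˡ; ∪-identityʳ; x∈p∪q⁺; x∈p∪q⁻; x∈p∩q⁺; p⊆p∪q; q⊆p∪q)
open import Data.Fin.Permutation using (Permutation′; _⟨$⟩ˡ_)
open import Data.Vec using (tabulate; lookup)
open import Data.Vec.Properties using (lookup-zipWith; lookup∘tabulate; tabulate∘lookup; tabulate-cong)
open import Data.Bool using (_∨_)
open import Data.Product using (_×_; _,_; proj₁; proj₂)
open import Data.Sum using (inj₁; inj₂)
open import Data.Maybe using (just; nothing)
open import Data.Unit using (tt)
open import Data.Empty using (⊥-elim)
open import Function.Bundles using (mk⇔)
open import Relation.Binary.PropositionalEquality using (_≡_; refl; sym; cong₂; subst; module ≡-Reasoning)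

module _ {k : ℕ} where

  ∪-mono : {A B C D : Subset k} → A ⊆ C → B ⊆ D → A ∪ B ⊆ C ∪ D
  ∪-mono {A} {B} A⊆C B⊆D x∈A∪B with x∈p∪q⁻ A B x∈A∪B
  ... | inj₁ x∈A = x∈p∪q⁺ (inj₁ (A⊆C x∈A))
  ... | inj₂ x∈B = x∈p∪q⁺ (inj₂ (B⊆D x∈B))

  ∪-⊆-∪-split : {M N P Q R U : Subset k} → Disjoint M N →
                P ⊆ M → Q ⊆ M → R ⊆ N → U ⊆ N →
                P ∪ R ⊆ Q ∪ U → P ⊆ Q × R ⊆ U
  ∪-⊆-∪-split {P = P} {Q} {R} {U} M∩N=∅ P⊆M Q⊆M R⊆N U⊆N P∪R⊆Q∪U =
    P⊆Q , R⊆U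
    where
    P⊆Q : P ⊆ Q
    P⊆Q x∈P with x∈p∪q⁻ Q U (P∪R⊆Q∪U (p⊆p∪q R x∈P))
    ... | inj₁ x∈Q = x∈Q
    ... | inj₂ x∈U = ⊥-elim (M∩N=∅ (_ , x∈p∩q⁺ (P⊆M x∈P , U⊆N x∈U)))
    R⊆U : R ⊆ U
    R⊆U x∈R with x∈p∪q⁻ Q U (P∪R⊆Q∪U (q⊆p∪q P R x∈R))
    ... | inj₁ x∈Q = ⊥-elim (M∩N=∅ (_ , x∈p∩q⁺ (Q⊆M x∈Q , R⊆N x∈R)))
    ... | inj₂ x∈U = x∈U

  img-∪ : (σ : Permutation′ k) (X Y : Subset k) → img σ (X ∪ Y) ≡ img σ X ∪ img σ Y
  img-∪ σ X Y = begin
    img σ (X ∪ Y)                            ≡⟨ tabulate-cong pointwise ⟩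
    tabulate (lookup (img σ X ∪ img σ Y))    ≡⟨ tabulate∘lookup _ ⟩
    img σ X ∪ img σ Y                        ∎
    where
    open ≡-Reasoning
    pointwise : (j : Fin k) → lookup (X ∪ Y) (σ ⟨$⟩ˡ j) ≡ lookup (img σ X ∪ img σ Y) j
    pointwise j = begin
      lookup (X ∪ Y) (σ ⟨$⟩ˡ j)                          ≡⟨ lookup-zipWith _∨_ (σ ⟨$⟩ˡ j) X Y ⟩
      lookup X (σ ⟨$⟩ˡ j) ∨ lookup Y (σ ⟨$⟩ˡ j)          ≡⟨ cong₂ _∨_ (lookup∘tabulate _ j) (lookup∘tabulate _ j) ⟨
      lookup (img σ X) j ∨ lookup (img σ Y) j            ≡⟨ lookup-zipWith _∨_ j (img σ X) (img σ Y) ⟨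
      lookup (img σ X ∪ img σ Y) j                       ∎

  ideal-resp : (c : Raw k) {A A' B B' : Subset k} → A ≡ A' → B ≡ B' → ideal c A B → ideal c A' B'
  ideal-resp c refl refl iAB = iAB

  𝟙 : Raw k
  𝟙 = mkRaw (λ Z → Z ≡ ⊥) (λ Z Z' → Z ≡ ⊥ × Z' ≡ ⊥)

  𝟙-isColoringProblem : IsColoringProblem ⊥ 𝟙
  𝟙-isColoringProblem = record
    { fam-sub    = λ { _ refl x∈⊥ → x∈⊥ }
    ; fam-empty  = refl
    ; fam-full   = refl
    ; ideal-int  = λ { _ _ (refl , refl) → refl , refl , λ x∈⊥ → x∈⊥ }
    ; ideal-down = λ { _ _ _ _ _ refl refl _ _ _ → refl , refl }
    ; ideal-diag = λ { _ refl → refl , refl }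
    }

  ·R-isColoringProblem : ProductClosed k
  ·R-isColoringProblem M N c d M∩N=∅ c-cp d-cp = record
    { fam-sub    = λ { _ (X , Y , fX , fY , refl) → ∪-mono (C.fam-sub X fX) (D.fam-sub Y fY) }
    ; fam-empty  = ⊥ , ⊥ , C.fam-empty , D.fam-empty , sym (∪-identityˡ ⊥)
    ; fam-full   = M , N , C.fam-full , D.fam-full , refl
    ; ideal-int  = ideal-int
    ; ideal-down = ideal-down
    ; ideal-diag = λ { _ (X , Y , fX , fY , refl) →
                       X , X , Y , Y , C.ideal-diag X fX , D.ideal-diag Y fY , refl , refl }
    }
    where
    module C = IsColoringProblem c-cp
    module D = IsColoringProblem d-cp

    split : {P Q R U : Subset k} → fam c P → fam c Q → fam d R → fam d U →
            P ∪ R ⊆ Q ∪ U → P ⊆ Q × R ⊆ U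
    split fP fQ fR fU = ∪-⊆-∪-split M∩N=∅ (C.fam-sub _ fP) (C.fam-sub _ fQ) (D.fam-sub _ fR) (D.fam-sub _ fU)

    ideal-int : ∀ S T → ideal (c ·R d) S T → fam (c ·R d) S × fam (c ·R d) T × S ⊆ T
    ideal-int _ _ (X , X' , Y , Y' , iXX' , iYY' , refl , refl)
      with C.ideal-int X X' iXX' | D.ideal-int Y Y' iYY'
    ... | fX , fX' , X⊆X' | fY , fY' , Y⊆Y' =
      (X , Y , fX , fY , refl) , (X' , Y' , fX' , fY' , refl) , ∪-mono X⊆X' Y⊆Y'

    ideal-down : ∀ S T S' T' → ideal (c ·R d) S T → fam (c ·R d) S' → fam (c ·R d) T' →
                 S ⊆ S' → S' ⊆ T' → T' ⊆ T → ideal (c ·R d) S' T'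
    ideal-down _ _ _ _ (X , X' , Y , Y' , iXX' , iYY' , refl , refl)
               (A , B , fA , fB , refl) (A' , B' , fA' , fB' , refl) S⊆S' S'⊆T' T'⊆T
      with C.ideal-int X X' iXX' | D.ideal-int Y Y' iYY'
    ... | fX , fX' , _ | fY , fY' , _ =
      A , A' , B , B' ,
      C.ideal-down X X' A A' iXX' fA fA' (proj₁ lower) (proj₁ middle) (proj₁ upper) ,
      D.ideal-down Y Y' B B' iYY' fB fB' (proj₂ lower) (proj₂ middle) (proj₂ upper) ,
      refl , refl
      where
      lower : X ⊆ A × Y ⊆ B
      lower = split fX fA fY fB S⊆S'
      middle : A ⊆ A' × B ⊆ B'
      middle = split fA fA' fB fB' S'⊆T'
      upper : A' ⊆ X' × B' ⊆ Y'
      upper = split fA' fX' fB' fY' T'⊆T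

  mapR-·R : (σ : Permutation′ k) (c d : Raw k) → mapR σ (c ·R d) ≈R (mapR σ c ·R mapR σ d)
  mapR-·R σ c d = record
    { fam-eq   = λ Z → mk⇔
        (λ { (_ , (X , Y , fX , fY , refl) , refl) →
             img σ X , img σ Y , (X , fX , refl) , (Y , fY , refl) , img-∪ σ X Y })
        (λ { (_ , _ , (X , fX , refl) , (Y , fY , refl) , refl) →
             X ∪ Y , (X , Y , fX , fY , refl) , sym (img-∪ σ X Y) })
    ; ideal-eq = λ Z Z' → mk⇔
        (λ { (_ , _ , (X , X' , Y , Y' , iXX' , iYY' , refl , refl) , refl , refl) →
             img σ X , img σ X' , img σ Y , img σ Y' ,
             (X , X' , iXX' , refl , refl) , (Y , Y' , iYY' , refl , refl) ,
             img-∪ σ X Y , img-∪ σ X' Y' })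
        (λ { (_ , _ , _ , _ , (X , X' , iXX' , refl , refl) , (Y , Y' , iYY' , refl , refl) , refl , refl) →
             X ∪ Y , X' ∪ Y' , (X , X' , Y , Y' , iXX' , iYY' , refl , refl) ,
             sym (img-∪ σ X Y) , sym (img-∪ σ X' Y') })
    }

  ·R-assoc : (c d e : Raw k) → ((c ·R d) ·R e) ≈R (c ·R (d ·R e))
  ·R-assoc c d e = record
    { fam-eq   = λ Z → mk⇔
        (λ { (_ , V , (X , Y , fX , fY , refl) , fV , refl) →
             X , Y ∪ V , fX , (Y , V , fY , fV , refl) , ∪-assoc X Y V })
        (λ { (X , _ , fX , (Y , V , fY , fV , refl) , refl) →
             X ∪ Y , V , (X , Y , fX , fY , refl) , fV , sym (∪-assoc X Y V) })
    ; ideal-eq = λ Z Z' → mk⇔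
        (λ { (_ , _ , V , V' , (X , X' , Y , Y' , iXX' , iYY' , refl , refl) , iVV' , refl , refl) →
             X , X' , Y ∪ V , Y' ∪ V' , iXX' , (Y , Y' , V , V' , iYY' , iVV' , refl , refl) ,
             ∪-assoc X Y V , ∪-assoc X' Y' V' })
        (λ { (X , X' , _ , _ , iXX' , (Y , Y' , V , V' , iYY' , iVV' , refl , refl) , refl , refl) →
             X ∪ Y , X' ∪ Y' , V , V' , (X , X' , Y , Y' , iXX' , iYY' , refl , refl) , iVV' ,
             sym (∪-assoc X Y V) , sym (∪-assoc X' Y' V') })
    }

  ·R-identityˡ : (c : Raw k) → (𝟙 ·R c) ≈R c
  ·R-identityˡ c = record
    { fam-eq   = λ Z → mk⇔
        (λ { (_ , Y , refl , fY , refl) → subst (fam c) (sym (∪-identityˡ Y)) fY })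
        (λ fZ → ⊥ , Z , refl , fZ , sym (∪-identityˡ Z))
    ; ideal-eq = λ Z Z' → mk⇔
        (λ { (_ , _ , Y , Y' , (refl , refl) , iYY' , refl , refl) →
             ideal-resp c (sym (∪-identityˡ Y)) (sym (∪-identityˡ Y')) iYY' })
        (λ iZZ' → ⊥ , ⊥ , Z , Z' , (refl , refl) , iZZ' , sym (∪-identityˡ Z) , sym (∪-identityˡ Z'))
    }

  ·R-identityʳ : (c : Raw k) → (c ·R 𝟙) ≈R c
  ·R-identityʳ c = record
    { fam-eq   = λ Z → mk⇔
        (λ { (X , _ , fX , refl , refl) → subst (fam c) (sym (∪-identityʳ X)) fX })
        (λ fZ → Z , ⊥ , fZ , refl , sym (∪-identityʳ Z))
    ; ideal-eq = λ Z Z' → mk⇔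
        (λ { (X , X' , _ , _ , iXX' , (refl , refl) , refl , refl) →
             ideal-resp c (sym (∪-identityʳ X)) (sym (∪-identityʳ X')) iXX' })
        (λ iZZ' → Z , Z' , ⊥ , ⊥ , iZZ' , (refl , refl) , sym (∪-identityʳ Z) , sym (∪-identityʳ Z'))
    }

  mapC-· : Naturality k
  mapC-· σ _ _ nothing  _        _ _ _ = tt
  mapC-· σ _ _ (just c) nothing  _ _ _ = tt
  mapC-· σ _ _ (just c) (just d) _ _ _ = mapR-·R σ c d

  ·-assoc : Associativity k
  ·-assoc _ _ _ nothing  _        _        _ _ _ _ _ _ = tt
  ·-assoc _ _ _ (just c) nothing  _        _ _ _ _ _ _ = tt
  ·-assoc _ _ _ (just c) (just d) nothing  _ _ _ _ _ _ = tt
  ·-assoc _ _ _ (just c) (just d) (just e) _ _ _ _ _ _ = ·R-assoc c d e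

  ·-identity : Unitality k
  ·-identity _ nothing  _ = tt , tt
  ·-identity _ (just c) _ = ·R-identityˡ c , ·R-identityʳ c

  ·-zero : Absorption k
  ·-zero _ _ nothing  _        _ _ _ _        = refl
  ·-zero _ _ (just c) nothing  _ _ _ _        = refl
  ·-zero _ _ (just c) (just d) _ _ _ (inj₁ ())
  ·-zero _ _ (just c) (just d) _ _ _ (inj₂ ())

mainTheorem5 : (k : ℕ) →
    InC {k} ⊥ unitC × ProductClosed k × Naturality k × Associativity k × Unitality k × Absorption k
mainTheorem5 k =
  cpC 𝟙 𝟙-isColoringProblem , ·R-isColoringProblem , mapC-· , ·-assoc , ·-identity , ·-zero
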